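{- For every $n\in\mathbb N$ with $n>1$, the formula $\mathrm{QUPARITY}_n$ can be refuted in the calculus Q-Res+S by no more than $3n+2$ applications of the rules S, R, U.
   Context: A QBF is $P.\phi$ with $\phi$ a CNF (clauses viewed as sets of literals $x$, $\bar x$) and $P=Q_1x_1\cdots Q_mx_m$ with $Q_i\in\{\forall,\exists\}$; $x_i<_P x_j$ iff $i<j$. The calculus Q-Res+S has rules: (A) any clause of $\phi$ may be derived (not counted as a step); (R) from derived clauses $C\lor x$ and $C'\lor\bar x$, with $x$ existential and $C\cup C'$ not a tautology, derive $C\lor C'$; (U) from a derived clause $C\lor l$ with $l$ a universal literal, $\bar l\notin C$, and every existential literal $k\in C$ satisfying $k<_P l$, derive $C$; (S) from a derived clause $C$ and a symmetry $\sigma$ of $P.\phi$, derive $\sigma(C)$. A bijection $\sigma$ of the literal set is admissible for $P$ if $\overline{\sigma(x)}=\sigma(\bar x)$ for every variable $x$ and $\sigma$ maps a variable $x_i$ to $x_j$ or $\bar x_j$ only if $x_i,x_j$ lie in the same quantifier block; an admissible $\sigma$ is a symmetry of $P.\phi$ if applying it to all literals of $\phi$ maps $\phi$ to itself up to reordering clauses and literals. A refutation derives the empty clause. $\mathrm{QUPARITY}_n$ ($n>1$) has prefix $\exists x_1\dots x_n\forall a_1a_2\exists y_2\dots y_n$ and clauses: $A_2=(\bar x_1\lor\bar x_2\lor\bar y_2\lor a_1\lor a_2)$, $B_2=(\bar x_1\lor x_2\lor y_2\lor a_1\lor a_2)$, $C_2=(x_1\lor\bar x_2\lor y_2\lor a_1\lor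 a_2)$, $D_2=(x_1\lor x_2\lor\bar y_2\lor a_1\lor a_2)$; for $j=3,\dots,n$: $A_j=(\bar y_{j-1}\lor\bar x_j\lor\bar y_j\lor a_1\lor a_2)$, $B_j=(\bar y_{j-1}\lor x_j\lor y_j\lor a_1\lor a_2)$, $C_j=(y_{j-1}\lor\bar x_j\lor y_j\lor a_1\lor a_2)$, $D_j=(y_{j-1}\lor x_j\lor\bar y_j\lor a_1\lor a_2)$; $E_1=(a_1\lor a_2\lor y_n)$, $E_2=(\bar a_1\lor\bar a_2\lor\bar y_n)$; and for $i=2,\dots,n$, clauses $A'_i,B'_i,C'_i,D'_i$ obtained from $A_i,B_i,C_i,D_i$ by replacing $a_1\lor a_2$ with $\bar a_1\lor\bar a_2$. -}

module Defs where

open import Data.Nat using (ℕ; zero; suc; _+_; _∸_; _<_; _≤_; _⊓_; _⊔_; _<ᵇ_; _≡ᵇ_)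
open import Data.Bool using (Bool; true; false; not; _∧_; _∨_; if_then_else_)
open import Data.Fin using (Fin; toℕ)
open import Data.Product using (_×_; _,_; proj₁; proj₂; Σ; ∃)
open import Data.Vec using (Vec; lookup; tabulate; replicate)
open import Data.List using (List; []; _∷_; map; concatMap; upTo; _++_)
open import Data.Bool.ListAction using (any)
open import Data.List.Membership.Propositional using (_∈_)
open import Data.List.Relation.Binary.Permutation.Propositional using (_↭_)
open import Relation.Binary.PropositionalEquality using (_≡_)
open import Relation.Nullary using (¬_)

data Quant : Set where
  ∃q ∀q : Quant

-- A prefix Q₁x₁ ⋯ Qₘxₘ: variables are Fin m, ordered by index (x_i <_P x_j iff i < j).
Prefix : ℕ → Set
Prefix m = Fin m → Quant

-- A literal: variable together with polarity (true = x, false = x̄).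
Lit : ℕ → Set
Lit m = Fin m × Bool

compl : ∀ {m} → Lit m → Lit m
compl (i , b) = (i , not b)

-- A clause is a *set* of literals, represented canonically:
-- for each variable, (is x in the clause , is x̄ in the clause).
Clause : ℕ → Set
Clause m = Vec (Bool × Bool) m

pick : Bool → Bool × Bool → Bool
pick true  p = proj₁ p
pick false p = proj₂ p

memb : ∀ {m} → Lit m → Clause m → Bool
memb (i , b) C = pick b (lookup C i)

_∈ᶜ_ : ∀ {m} → Lit m → Clause m → Set
l ∈ᶜ C = memb l C ≡ true

_∉ᶜ_ : ∀ {m} → Lit m → Clause m → Set
l ∉ᶜ C = memb l C ≡ false

emptyC : ∀ {m} → Clause m
emptyC = replicate _ (false , false)

remove : ∀ {m} → Lit m → Clause m → Clause m
remove {m} (i , b) C =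
  tabulate λ j → ( memb (j , true) C ∧ not (isL j true)
                 , memb (j , false) C ∧ not (isL j false))
  where
  isL : Fin m → Bool → Bool
  isL j c = (toℕ j ≡ᵇ toℕ i) ∧ (if b then c else not c)

union : ∀ {m} → Clause m → Clause m → Clause m
union C D = tabulate λ j → ( memb (j , true) C ∨ memb (j , true) D
                           , memb (j , false) C ∨ memb (j , false) D)

Tautology : ∀ {m} → Clause m → Set
Tautology C = ∃ λ i → (i , true) ∈ᶜ C × (i , false) ∈ᶜ C

record QBF (m : ℕ) : Set where
  constructor _·_
  field
    prefix : Prefix m
    matrix : List (Clause m)
open QBF public

SameBlock : ∀ {m} → Prefix m → Fin m → Fin m → Set
SameBlock P i j = ∀ k → (toℕ i ⊓ toℕ j) ≤ toℕ k → toℕ k ≤ (toℕ i ⊔ toℕ j) → P k ≡ P i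

record Admissible {m} (P : Prefix m) : Set where
  field
    σ      : Lit m → Lit m
    σ⁻¹    : Lit m → Lit m
    invˡ   : ∀ l → σ⁻¹ (σ l) ≡ l
    invʳ   : ∀ l → σ (σ⁻¹ l) ≡ l
    σ-compl : ∀ l → σ (compl l) ≡ compl (σ l)
    σ-block : ∀ i b → SameBlock P i (proj₁ (σ (i , b)))
open Admissible public

applyC : ∀ {m} {P : Prefix m} → Admissible P → Clause m → Clause m
applyC s C = tabulate λ j → (memb (σ⁻¹ s (j , true)) C , memb (σ⁻¹ s (j , false)) C)

IsSymmetry : ∀ {m} (F : QBF m) → Admissible (prefix F) → Set
IsSymmetry F s = map (applyC s) (matrix F) ↭ matrix F

Resolvent : ∀ {m} → Prefix m → Clause m → Clause m → Clause m → Set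
Resolvent P D₁ D₂ R = ∃ λ x →
    P x ≡ ∃q × (x , true) ∈ᶜ D₁ × (x , false) ∈ᶜ D₂
  × ¬ Tautology (union (remove (x , true) D₁) (remove (x , false) D₂))
  × R ≡ union (remove (x , true) D₁) (remove (x , false) D₂)

UReduct : ∀ {m} → Prefix m → Clause m → Clause m → Set
UReduct P D R = ∃ λ l →
    P (proj₁ l) ≡ ∀q × l ∈ᶜ D
  × compl l ∉ᶜ remove l D
  × (∀ k → k ∈ᶜ remove l D → P (proj₁ k) ≡ ∃q → toℕ (proj₁ k) < toℕ (proj₁ l))
  × R ≡ remove l D

-- A Q-Res+S derivation: Γ is the list of derived clauses (latest first),
-- k counts the applications of the rules S, R, U (rule A is not counted).
data Derivation {m} (F : QBF m) : List (Clause m) → ℕ → Set where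
  start : Derivation F [] 0
  ruleA : ∀ {Γ k C} → Derivation F Γ k → C ∈ matrix F → Derivation F (C ∷ Γ) k
  ruleR : ∀ {Γ k D₁ D₂ R} → Derivation F Γ k → D₁ ∈ Γ → D₂ ∈ Γ →
          Resolvent (prefix F) D₁ D₂ R → Derivation F (R ∷ Γ) (suc k)
  ruleU : ∀ {Γ k D R} → Derivation F Γ k → D ∈ Γ →
          UReduct (prefix F) D R → Derivation F (R ∷ Γ) (suc k)
  ruleS : ∀ {Γ k D} (s : Admissible (prefix F)) → Derivation F Γ k → D ∈ Γ →
          IsSymmetry F s → Derivation F (applyC s D ∷ Γ) (suc k)

RefutableWithin : ∀ {m} → QBF m → ℕ → Set
RefutableWithin F bound =
  Σ (List _) λ Γ → Σ ℕ λ k → Derivation F Γ k × emptyC ∈ Γ × k ≤ bound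

-- QUPARITY_n, over the 2n+1 variables (0-based indices):
--   x_i ↦ i-1 (1 ≤ i ≤ n),  a₁ ↦ n,  a₂ ↦ n+1,  y_j ↦ n+j (2 ≤ j ≤ n).

mkClause : ∀ {m} → List (ℕ × Bool) → Clause m
mkClause L = tabulate λ j → (any (is (toℕ j) true) L , any (is (toℕ j) false) L)
  where
  eqB : Bool → Bool → Bool
  eqB true c = c
  eqB false c = not c
  is : ℕ → Bool → ℕ × Bool → Bool
  is v b (w , c) = (v ≡ᵇ w) ∧ eqB b c

module QUParity (n : ℕ) where
  xv : ℕ → ℕ
  xv i = i ∸ 1
  a₁ a₂ : ℕ
  a₁ = n
  a₂ = suc n
  yv : ℕ → ℕ
  yv j = n + j
  prev : ℕ → ℕ
  prev j = if j ≡ᵇ 2 then xv 1 else yv (j ∸ 1)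

  -- A_j, B_j, C_j, D_j with universal part (a₁ ∨ a₂) if u = true,
  -- and (ā₁ ∨ ā₂) if u = false (the primed clauses).
  block : Bool → ℕ → List (List (ℕ × Bool))
  block u j =
      ((prev j , false) ∷ (xv j , false) ∷ (yv j , false) ∷ (a₁ , u) ∷ (a₂ , u) ∷ [])
    ∷ ((prev j , false) ∷ (xv j , true)  ∷ (yv j , true)  ∷ (a₁ , u) ∷ (a₂ , u) ∷ [])
    ∷ ((prev j , true)  ∷ (xv j , false) ∷ (yv j , true)  ∷ (a₁ , u) ∷ (a₂ , u) ∷ [])
    ∷ ((prev j , true)  ∷ (xv j , true)  ∷ (yv j , false) ∷ (a₁ , u) ∷ (a₂ , u) ∷ [])
    ∷ []

  js : List ℕ
  js = map (2 +_) (upTo (n ∸ 1))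

  E₁ E₂ : List (ℕ × Bool)
  E₁ = (a₁ , true) ∷ (a₂ , true) ∷ (yv n , true) ∷ []
  E₂ = (a₁ , false) ∷ (a₂ , false) ∷ (yv n , false) ∷ []

  prefixQ : Prefix (suc (n + n))
  prefixQ i = if toℕ i <ᵇ n then ∃q else if toℕ i <ᵇ (n + 2) then ∀q else ∃q

  clauses : List (List (ℕ × Bool))
  clauses = concatMap (λ j → block true j ++ block false j) js ++ (E₁ ∷ E₂ ∷ [])

  formula : QBF (suc (n + n))
  formula = prefixQ · map mkClause clauses

QUPARITY : (n : ℕ) → QBF (suc (n + n))
QUPARITY n = QUParity.formula n

module Submission where

-- Resolving E₁ = a₁ ∨ a₂ ∨ y_n successively with D_n, …, D_2 (where D_j = y_{j-1} ∨ x_j ∨ ȳ_j ∨ a₁ ∨ a₂)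
-- walks down the chain y_j = y_{j-1} ⊕ x_j and leaves x₁ ∨ ⋯ ∨ x_n ∨ a₁ ∨ a₂; universal reduction
-- then removes a₂ and a₁. Negating x_{t+1}, a₁, a₂ and y_{t+1}, …, y_n preserves every parity
-- constraint and swaps each clause with its primed copy, so it is a symmetry σ_t. Since σ_t maps
-- x₁ ∨ ⋯ ∨ x_{t+1} to x₁ ∨ ⋯ ∨ x_t ∨ x̄_{t+1}, one application of S and one resolution remove x_{t+1};
-- doing this for t = n - 1, …, 0 reaches the empty clause after (n - 1) + 2 + 2n steps.

open import Defs
open import Data.Nat using (ℕ; zero; suc; _+_; _*_; _∸_; _<_; _≤_; z≤n; s≤s; _<ᵇ_; _≡ᵇ_)
open import Data.Nat.Properties
open import Data.Nat.Solver using (module +-*-Solver)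
open import Data.Bool using (Bool; true; false; not; _∧_; _∨_; _xor_; if_then_else_; T)
open import Data.Bool.Properties using (T-≡; T-∧; T-∨; ⇔→≡; ¬-not; xor-assoc; xor-same; not-distribʳ-xor)
open import Data.Bool.ListAction using (any)
open import Data.Empty using (⊥; ⊥-elim)
import Data.Fin as Fin
open import Data.Fin using (Fin; toℕ; fromℕ<)
open import Data.Fin.Properties using (toℕ-fromℕ<; toℕ-injective)
open import Data.Product using (_×_; _,_; proj₁; proj₂; Σ)
open import Data.Product.Function.NonDependent.Propositional using (_×-⇔_)
open import Data.Sum using (_⊎_; inj₁; inj₂)
open import Data.Sum.Function.Propositional using (_⊎-⇔_)
open import Data.Vec using (lookup; tabulate)
open import Data.Vec.Properties using (lookup∘tabulate; tabulate∘lookup; tabulate-cong)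
open import Data.List using (List; []; _∷_; map; concatMap; _++_)
open import Data.List.Properties using (map-++; map-∘; map-cong)
open import Data.List.Membership.Propositional using (_∈_)
open import Data.List.Membership.Propositional.Properties
  using (∈-map⁺; ∈-map⁻; ∈-upTo⁺; ∈-upTo⁻; ∈-++⁺ˡ; ∈-++⁺ʳ; ∈-concatMap⁺)
import Data.List.Relation.Unary.Any as Any
open import Data.List.Relation.Unary.Any using (here; there)
open import Data.List.Relation.Unary.Any.Properties using (any⇔)
open import Data.List.Relation.Binary.Permutation.Propositional
  using (_↭_; ↭-refl; ↭-reflexive; ↭-trans; swap)
import Data.List.Relation.Binary.Permutation.Propositional.Properties as ↭
open import Function.Base using (_∘′_; case_of_)
open import Function.Bundles using (_⇔_; mk⇔; Equivalence)
open import Function.Properties.Equivalence using () renaming (refl to ⇔-refl; trans to ⇔-trans; sym to ⇔-sym)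
open import Function.Related.TypeIsomorphisms using (¬-cong-⇔)
open import Relation.Binary.PropositionalEquality
  using (_≡_; _≢_; refl; sym; trans; cong; cong₂; subst; module ≡-Reasoning)
open import Relation.Nullary using (¬_)

open Equivalence using (to; from)

∨-≡-true : ∀ {x y} → x ∨ y ≡ true ⇔ (x ≡ true ⊎ y ≡ true)
∨-≡-true = ⇔-trans (⇔-sym T-≡) (⇔-trans T-∨ (T-≡ ⊎-⇔ T-≡))

∧-≡-true : ∀ {x y} → x ∧ y ≡ true ⇔ (x ≡ true × y ≡ true)
∧-≡-true = ⇔-trans (⇔-sym T-≡) (⇔-trans T-∧ (T-≡ ×-⇔ T-≡))

not-≡-true : ∀ {x} → not x ≡ true ⇔ x ≢ true
not-≡-true {true}  = mk⇔ (λ ()) (λ x≢true → ⊥-elim (x≢true refl))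
not-≡-true {false} = mk⇔ (λ _ ()) (λ _ → refl)

xor-involutive : ∀ x y → x xor (x xor y) ≡ y
xor-involutive x y = trans (sym (xor-assoc x x y)) (cong (_xor y) (xor-same x))

map-concatMap-↭ : ∀ {A B : Set} (g : B → B) (f : A → List B) xs →
  (∀ {x} → x ∈ xs → map g (f x) ↭ f x) → map g (concatMap f xs) ↭ concatMap f xs
map-concatMap-↭ g f []       _    = ↭-refl
map-concatMap-↭ g f (x ∷ xs) perm = ↭-trans (↭-reflexive (map-++ g (f x) (concatMap f xs)))
  (↭.++⁺ (perm (here refl)) (map-concatMap-↭ g f xs (perm ∘′ there)))

<ᵇ-true : ∀ {v n} → v < n → (v <ᵇ n) ≡ true
<ᵇ-true v<n = to T-≡ (<⇒<ᵇ v<n)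

<ᵇ-false : ∀ {v n} → n ≤ v → (v <ᵇ n) ≡ false
<ᵇ-false n≤v = ¬-not λ v<ᵇn → ≤⇒≯ n≤v (<ᵇ⇒< _ _ (from T-≡ v<ᵇn))

<ᵇ-suc : ∀ t j → (t <ᵇ suc j) ≡ (t <ᵇ j) xor (j ≡ᵇ t)
<ᵇ-suc zero    zero    = refl
<ᵇ-suc zero    (suc j) = refl
<ᵇ-suc (suc t) zero    = refl
<ᵇ-suc (suc t) (suc j) = <ᵇ-suc t j

Lits : Set₁
Lits = ℕ → Bool → Set

record Exactly {m} (L : Lits) (C : Clause m) : Set where
  constructor exactly
  field
    lits : ∀ i b → (i , b) ∈ᶜ C ⇔ L (toℕ i) b
open Exactly

_≐_ : Lits → Lits → Set
L ≐ L′ = ∀ v b → L v b ⇔ L′ v b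

_∪ˡ_ : Lits → Lits → Lits
(L ∪ˡ L′) v b = L v b ⊎ L′ v b

_∖ˡ_ : Lits → ℕ × Bool → Lits
(L ∖ˡ l) v b = L v b × (v , b) ≢ l

Positive : (ℕ → Set) → Lits
Positive S v b = b ≡ true × S v

Negative : ℕ → Lits
Negative x v b = b ≡ false × v ≡ x

litsOf : List (ℕ × Bool) → Lits
litsOf L v b = (v , b) ∈ L

-- Definitionally equal to the where-bound literal tests inside remove and mkClause.
litTest : ℕ → Bool → ℕ × Bool → Bool
litTest v b (w , c) = (v ≡ᵇ w) ∧ (if b then c else not c)

litTest-≡-true : ∀ v w b c → litTest v b (w , c) ≡ true ⇔ (v , c) ≡ (w , b)
litTest-≡-true v w b c = mk⇔ (λ e → let (e₁ , e₂) = to ∧-≡-true e in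
                                     cong₂ _,_ (≡ᵇ⇒≡ v w (from T-≡ e₁)) (sign b c e₂))
                             same
  where
  sign : ∀ b c → (if b then c else not c) ≡ true → c ≡ b
  sign true  true  _ = refl
  sign false false _ = refl
  same : ∀ {v w b c} → (v , c) ≡ (w , b) → litTest v b (w , c) ≡ true
  same {v} {c = true}  refl = from ∧-≡-true (to T-≡ (≡⇒≡ᵇ v v refl) , refl)
  same {v} {c = false} refl = from ∧-≡-true (to T-≡ (≡⇒≡ᵇ v v refl) , refl)

memb-tabulate : ∀ {m} (f : Fin m → Bool × Bool) i b → memb (i , b) (tabulate f) ≡ pick b (f i)
memb-tabulate f i b = cong (pick b) (lookup∘tabulate f i)

memb-union : ∀ {m} (C D : Clause m) i b → memb (i , b) (union C D) ≡ memb (i , b) C ∨ memb (i , b) D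
memb-union C D i true  = memb-tabulate _ i true
memb-union C D i false = memb-tabulate _ i false

memb-remove : ∀ {m} (C : Clause m) i b j c →
  memb (j , c) (remove (i , b) C) ≡ memb (j , c) C ∧ not (litTest (toℕ j) b (toℕ i , c))
memb-remove C i b j true  = memb-tabulate _ j true
memb-remove C i b j false = memb-tabulate _ j false

memb-mkClause : ∀ {m} (i : Fin m) b L → memb (i , b) (mkClause L) ≡ any (litTest (toℕ i) b) L
memb-mkClause i true  L = memb-tabulate _ i true
memb-mkClause i false L = memb-tabulate _ i false

Exactly-resp : ∀ {m} {L L′ : Lits} {C : Clause m} → L ≐ L′ → Exactly L C → Exactly L′ C
Exactly-resp L≐L′ C≐L = exactly λ i b → ⇔-trans (lits C≐L i b) (L≐L′ (toℕ i) b)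

Exactly-unique : ∀ {m} {L} {C D : Clause m} → Exactly L C → Exactly L D → C ≡ D
Exactly-unique {C = C} {D} C≐L D≐L = begin
  C                    ≡⟨ tabulate∘lookup C ⟨
  tabulate (lookup C)  ≡⟨ tabulate-cong (λ i → cong₂ _,_ (same i true) (same i false)) ⟩
  tabulate (lookup D)  ≡⟨ tabulate∘lookup D ⟩
  D                    ∎
  where
  open ≡-Reasoning
  same : ∀ i b → memb (i , b) C ≡ memb (i , b) D
  same i b = ⇔→≡ (⇔-trans (lits C≐L i b) (⇔-sym (lits D≐L i b)))

Exactly-union : ∀ {m} {L L′ C D} → Exactly {m} L C → Exactly L′ D → Exactly (L ∪ˡ L′) (union C D)
Exactly-union {C = C} {D} C≐L D≐L′ = exactly λ i b →
  subst (λ x → x ≡ true ⇔ _) (sym (memb-union C D i b))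
        (⇔-trans ∨-≡-true (lits C≐L i b ⊎-⇔ lits D≐L′ i b))

Exactly-emptyC : ∀ {m} → Exactly {m} (λ _ _ → ⊥) emptyC
Exactly-emptyC = exactly λ i b → mk⇔ (λ i∈ → case trans (sym i∈) (memb-emptyC i b) of λ ()) ⊥-elim
  where
  memb-emptyC : ∀ {k} (i : Fin k) b → memb (i , b) emptyC ≡ false
  memb-emptyC Fin.zero    true  = refl
  memb-emptyC Fin.zero    false = refl
  memb-emptyC (Fin.suc i) b     = memb-emptyC i b

Exactly-remove : ∀ {m} {L C} (i : Fin m) b → Exactly L C → Exactly (L ∖ˡ (toℕ i , b)) (remove (i , b) C)
Exactly-remove {C = C} i b C≐L = exactly λ j c →
  subst (λ x → x ≡ true ⇔ _) (sym (memb-remove C i b j c))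
        (⇔-trans ∧-≡-true
                 (lits C≐L j c ×-⇔ ⇔-trans not-≡-true (¬-cong-⇔ (litTest-≡-true (toℕ j) (toℕ i) b c))))

Exactly-mkClause : ∀ {m} L → Exactly {m} (litsOf L) (mkClause L)
Exactly-mkClause L = exactly λ i b → mkClause-lits i b
  where
  swapSigns : ∀ {v w : ℕ} {b c : Bool} → (v , c) ≡ (w , b) → (v , b) ≡ (w , c)
  swapSigns refl = refl
  test⇔ : ∀ {v b x} → T (litTest v b x) ⇔ ((v , b) ≡ x)
  test⇔ {v} {b} {w , c} = ⇔-trans T-≡ (⇔-trans (litTest-≡-true v w b c) (mk⇔ swapSigns swapSigns))
  mkClause-lits : ∀ i b → (i , b) ∈ᶜ mkClause L ⇔ litsOf L (toℕ i) b
  mkClause-lits i b =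
    subst (λ x → x ≡ true ⇔ (toℕ i , b) ∈ L) (sym (memb-mkClause i b L))
          (⇔-trans (⇔-sym T-≡) (⇔-trans (⇔-sym any⇔) (mk⇔ (Any.map (to test⇔)) (Any.map (from test⇔)))))

Positive-resp : ∀ {S S′ : ℕ → Set} → (∀ v → S v ⇔ S′ v) → Positive S ≐ Positive S′
Positive-resp S⇔S′ v b = ⇔-refl ×-⇔ S⇔S′ v

litsOf-oneNegative : ∀ {L x} → (x , false) ∈ L → (∀ {v} → (v , false) ∈ L → v ≡ x) →
  litsOf L ≐ (Negative x ∪ˡ Positive (λ v → (v , true) ∈ L))
litsOf-oneNegative {L} {x} x̄∈L onlyNegative v b = mk⇔ (fwd b) bwd
  where
  fwd : ∀ b → (v , b) ∈ L → (Negative x ∪ˡ Positive (λ v → (v , true) ∈ L)) v b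
  fwd true  v∈L = inj₂ (refl , v∈L)
  fwd false v̄∈L = inj₁ (refl , onlyNegative v̄∈L)
  bwd : (Negative x ∪ˡ Positive (λ v → (v , true) ∈ L)) v b → (v , b) ∈ L
  bwd (inj₁ (refl , refl)) = x̄∈L
  bwd (inj₂ (refl , v∈L)) = v∈L

flipLit : (ℕ → Bool) → ℕ × Bool → ℕ × Bool
flipLit p (v , b) = (v , p v xor b)

SameBlock-refl : ∀ {m} (P : Prefix m) i → SameBlock P i i
SameBlock-refl P i k i≤k k≤i = cong P (toℕ-injective (≤-antisym
  (subst (toℕ k ≤_) (⊔-idem (toℕ i)) k≤i) (subst (_≤ toℕ k) (⊓-idem (toℕ i)) i≤k)))

flipping : ∀ {m} (P : Prefix m) → (ℕ → Bool) → Admissible P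
flipping P p = record
  { σ       = σ′
  ; σ⁻¹     = σ′
  ; invˡ    = σ′-involutive
  ; invʳ    = σ′-involutive
  ; σ-compl = λ (i , b) → cong (i ,_) (sym (not-distribʳ-xor (p (toℕ i)) b))
  ; σ-block = λ i _ → SameBlock-refl P i
  }
  where
  σ′ : Lit _ → Lit _
  σ′ (i , b) = (i , p (toℕ i) xor b)
  σ′-involutive : ∀ l → σ′ (σ′ l) ≡ l
  σ′-involutive (i , b) = cong (i ,_) (xor-involutive (p (toℕ i)) b)

flipLits : (ℕ → Bool) → Lits → Lits
flipLits p L v b = L v (p v xor b)

Exactly-flipping : ∀ {m} {P : Prefix m} {L C} p →
  Exactly L C → Exactly (flipLits p L) (applyC (flipping P p) C)
Exactly-flipping {P = P} {C = C} p C≐L = exactly λ i b →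
  subst (λ x → x ≡ true ⇔ _) (sym (memb-applyC i b)) (lits C≐L i (p (toℕ i) xor b))
  where
  memb-applyC : ∀ i b → memb (i , b) (applyC (flipping P p) C) ≡ memb (i , p (toℕ i) xor b) C
  memb-applyC i true  = memb-tabulate _ i true
  memb-applyC i false = memb-tabulate _ i false

applyC-flipping-mkClause : ∀ {m} (P : Prefix m) p L →
  applyC (flipping P p) (mkClause L) ≡ mkClause (map (flipLit p) L)
applyC-flipping-mkClause P p L =
  Exactly-unique (Exactly-flipping {P = P} p (Exactly-mkClause L))
                 (Exactly-resp flipped (Exactly-mkClause (map (flipLit p) L)))
  where
  flipped : litsOf (map (flipLit p) L) ≐ flipLits p (litsOf L)
  flipped v b = mk⇔ fwd bwd
    where
    unflip : ∀ {w c} → (v , b) ≡ flipLit p (w , c) → (w , c) ∈ L → (v , p v xor b) ∈ L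
    unflip {w} {c} refl = subst (_∈ L) (cong (w ,_) (sym (xor-involutive (p w) c)))
    fwd : (v , b) ∈ map (flipLit p) L → (v , p v xor b) ∈ L
    fwd h = let (_ , w∈ , eq) = ∈-map⁻ (flipLit p) h in unflip eq w∈
    bwd : (v , p v xor b) ∈ L → (v , b) ∈ map (flipLit p) L
    bwd h = subst (_∈ map (flipLit p) L) (cong (v ,_) (xor-involutive (p v) b)) (∈-map⁺ (flipLit p) h)

flipping-isSymmetry : ∀ {m} (P : Prefix m) p cls →
  map (map (flipLit p)) cls ↭ cls → IsSymmetry (P · map mkClause cls) (flipping P p)
flipping-isSymmetry P p cls perm = ↭-trans (↭-reflexive mapped) (↭.map⁺ mkClause perm)
  where
  open ≡-Reasoning
  mapped : map (applyC (flipping P p)) (map mkClause cls) ≡ map mkClause (map (map (flipLit p)) cls)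
  mapped = begin
    map (applyC (flipping P p)) (map mkClause cls)   ≡⟨ map-∘ cls ⟨
    map (applyC (flipping P p) ∘′ mkClause) cls       ≡⟨ map-cong (applyC-flipping-mkClause P p) cls ⟩
    map (mkClause ∘′ map (flipLit p)) cls             ≡⟨ map-∘ cls ⟩
    map mkClause (map (map (flipLit p)) cls)          ∎

positive-¬negative : ∀ {m} {S} {C : Clause m} → Exactly (Positive S) C → ∀ i → (i , false) ∉ᶜ C
positive-¬negative C≐S i = ¬-not λ i̅∈C → case proj₁ (to (lits C≐S i false) i̅∈C) of λ ()

positive-¬Tautology : ∀ {m} {S} {C : Clause m} → Exactly (Positive S) C → ¬ Tautology C
positive-¬Tautology C≐S (i , _ , i̅∈C) with () ← trans (sym i̅∈C) (positive-¬negative C≐S i)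

positive-resolvent : ∀ {m} {P : Prefix m} {S T S′ : ℕ → Set} {C D : Clause m} (x : Fin m) →
  P x ≡ ∃q → Exactly (Positive S) C → Exactly (Negative (toℕ x) ∪ˡ Positive T) D → S (toℕ x) →
  (∀ v → ((S v × v ≢ toℕ x) ⊎ T v) ⇔ S′ v) →
  Σ (Clause m) λ R → Resolvent P C D R × Exactly (Positive S′) R
positive-resolvent {m} {S = S} {T} {S′} {C} {D} x ∃x C≐S D≐x̄T Sx resolvedVars =
  R , (x , ∃x , from (lits C≐S x true) (refl , Sx) , from (lits D≐x̄T x false) (inj₁ (refl , refl))
         , positive-¬Tautology R≐S′ , refl)
    , R≐S′
  where
  R : Clause m
  R = union (remove (x , true) C) (remove (x , false) D)
  R-lits : Lits
  R-lits = (Positive S ∖ˡ (toℕ x , true)) ∪ˡ ((Negative (toℕ x) ∪ˡ Positive T) ∖ˡ (toℕ x , false))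
  resolved : R-lits ≐ Positive S′
  resolved v b = mk⇔ fwd bwd
    where
    fwd : R-lits v b → Positive S′ v b
    fwd (inj₁ ((refl , s) , v≢x)) = refl , to (resolvedVars v) (inj₁ (s , λ v≡x → v≢x (cong (_, true) v≡x)))
    fwd (inj₂ (inj₁ (refl , v≡x) , v≢x)) = ⊥-elim (v≢x (cong (_, false) v≡x))
    fwd (inj₂ (inj₂ (refl , t) , _)) = refl , to (resolvedVars v) (inj₂ t)
    bwd : Positive S′ v b → R-lits v b
    bwd (refl , s′) with from (resolvedVars v) s′
    ... | inj₁ (s , v≢x) = inj₁ ((refl , s) , λ v≡x → v≢x (cong proj₁ v≡x))
    ... | inj₂ t         = inj₂ (inj₂ (refl , t) , λ ())
  R≐S′ : Exactly (Positive S′) R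
  R≐S′ = Exactly-resp resolved (Exactly-union (Exactly-remove x true C≐S) (Exactly-remove x false D≐x̄T))

positive-reduct : ∀ {m} {P : Prefix m} {C : Clause m} (a : Fin m) →
  P a ≡ ∀q → Exactly (Positive (_< suc (toℕ a))) C →
  Σ (Clause m) λ R → UReduct P C R × Exactly (Positive (_< toℕ a)) R
positive-reduct {m} {C = C} a ∀a C≐S =
  R , ((a , true) , ∀a , from (lits C≐S a true) (refl , ≤-refl) , positive-¬negative R≐S a
        , (λ (i , b) i∈R _ → proj₂ (to (lits R≐S i b) i∈R)) , refl)
    , R≐S
  where
  R : Clause m
  R = remove (a , true) C
  reduced : (Positive (_< suc (toℕ a)) ∖ˡ (toℕ a , true)) ≐ Positive (_< toℕ a)
  reduced v b = mk⇔
    (λ ((b≡true , v<1+a) , v≢a) → b≡true , ≤∧≢⇒< (m<1+n⇒m≤n v<1+a) λ v≡a → v≢a (cong₂ _,_ v≡a b≡true))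
    (λ (b≡true , v<a) → (b≡true , m≤n⇒m≤1+n v<a) , λ va≡ → <⇒≢ v<a (cong proj₁ va≡))
  R≐S : Exactly (Positive (_< toℕ a)) R
  R≐S = Exactly-resp reduced (Exactly-remove a true C≐S)

record DerivesWithin {m} (F : QBF m) (L : Lits) (bound : ℕ) : Set where
  constructor derived
  field
    {history} : List (Clause m)
    {steps}   : ℕ
    {clause}  : Clause m
    derivation : Derivation F (clause ∷ history) steps
    exact      : Exactly L clause
    within     : steps ≤ bound

module _ {m} {F : QBF m} where

  DerivesWithin-weaken : ∀ {L b b′} → b ≤ b′ → DerivesWithin F L b → DerivesWithin F L b′
  DerivesWithin-weaken b≤b′ (derived d C≐L s≤b) = derived d C≐L (≤-trans s≤b b≤b′)

  DerivesWithin-resp : ∀ {L L′ b} → L ≐ L′ → DerivesWithin F L b → DerivesWithin F L′ b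
  DerivesWithin-resp L≐L′ (derived d C≐L s≤b) = derived d (Exactly-resp L≐L′ C≐L) s≤b

  axiom : ∀ {L C} → C ∈ matrix F → Exactly L C → DerivesWithin F L 0
  axiom C∈F C≐L = derived (ruleA start C∈F) C≐L z≤n

  resolveWithAxiom : ∀ {S T S′ b D v} → DerivesWithin F (Positive S) b → D ∈ matrix F →
    (x : Fin m) → toℕ x ≡ v → prefix F x ≡ ∃q → Exactly (Negative v ∪ˡ Positive T) D → S v →
    (∀ w → ((S w × w ≢ v) ⊎ T w) ⇔ S′ w) → DerivesWithin F (Positive S′) (suc b)
  resolveWithAxiom (derived d C≐S s≤b) D∈F x refl ∃x D≐x̄T Sx resolvedVars =
    let (R , resolvent , R≐S′) = positive-resolvent x ∃x C≐S D≐x̄T Sx resolvedVars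
    in derived (ruleR (ruleA d D∈F) (there (here refl)) (here refl) resolvent) R≐S′ (s≤s s≤b)

  resolveWithFlipped : ∀ {S T S′ b v} p → IsSymmetry F (flipping (prefix F) p) →
    DerivesWithin F (Positive S) b → (x : Fin m) → toℕ x ≡ v → prefix F x ≡ ∃q →
    flipLits p (Positive S) ≐ (Negative v ∪ˡ Positive T) → S v →
    (∀ w → ((S w × w ≢ v) ⊎ T w) ⇔ S′ w) → DerivesWithin F (Positive S′) (2 + b)
  resolveWithFlipped p σ-sym (derived d C≐S s≤b) x refl ∃x flipped Sx resolvedVars =
    let σC≐x̄T = Exactly-resp flipped (Exactly-flipping {P = prefix F} p C≐S)
        (R , resolvent , R≐S′) = positive-resolvent x ∃x C≐S σC≐x̄T Sx resolvedVars
        dσ = ruleS (flipping (prefix F) p) d (here refl) σ-sym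
    in derived (ruleR dσ (there (here refl)) (here refl) resolvent) R≐S′ (s≤s (s≤s s≤b))

  reduceUniversal : ∀ {b v} (a : Fin m) → toℕ a ≡ v → prefix F a ≡ ∀q →
    DerivesWithin F (Positive (_< suc v)) b → DerivesWithin F (Positive (_< v)) (suc b)
  reduceUniversal a refl ∀a (derived d C≐S s≤b) =
    let (R , reduct , R≐S′) = positive-reduct a ∀a C≐S
    in derived (ruleU d (here refl) reduct) R≐S′ (s≤s s≤b)

  refutation : ∀ {L b} → (∀ v b → ¬ L v b) → DerivesWithin F L b → RefutableWithin F b
  refutation {L} L-empty (derived d C≐L s≤b) =
    _ , _ , d , here (Exactly-unique (Exactly-resp none≐L Exactly-emptyC) C≐L) , s≤b
    where
    none≐L : (λ _ _ → ⊥) ≐ L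
    none≐L v b = mk⇔ ⊥-elim (L-empty v b)

  descend : ∀ (L : ℕ → Lits) s K →
    (∀ k → k < K → ∀ {b} → DerivesWithin F (L (suc k)) b → DerivesWithin F (L k) (s + b)) →
    ∀ {b} → DerivesWithin F (L K) b → DerivesWithin F (L 0) (K * s + b)
  descend L s zero    step d = d
  descend L s (suc K) step {b} d =
    DerivesWithin-weaken (≤-reflexive reassociate)
      (descend L s K (λ k k<K → step k (m≤n⇒m≤1+n k<K)) (step K ≤-refl d))
    where
    reassociate : K * s + (s + b) ≡ suc K * s + b
    reassociate = trans (sym (+-assoc (K * s) s b)) (cong (_+ b) (+-comm (K * s) s))

-- For P X Y = y_{j-1} x_j y_j these are A_j, B_j, C_j, D_j (u = true) or their primed copies (u = false);
-- they force Y = P ⊕ X.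
parityBlock : (P X Y A₁ A₂ : ℕ) → Bool → List (List (ℕ × Bool))
parityBlock P X Y A₁ A₂ u =
    ((P , false) ∷ (X , false) ∷ (Y , false) ∷ (A₁ , u) ∷ (A₂ , u) ∷ [])
  ∷ ((P , false) ∷ (X , true)  ∷ (Y , true)  ∷ (A₁ , u) ∷ (A₂ , u) ∷ [])
  ∷ ((P , true)  ∷ (X , false) ∷ (Y , true)  ∷ (A₁ , u) ∷ (A₂ , u) ∷ [])
  ∷ ((P , true)  ∷ (X , true)  ∷ (Y , false) ∷ (A₁ , u) ∷ (A₂ , u) ∷ [])
  ∷ []

parityBlock-flip : ∀ q {P X Y A₁ A₂} u → q A₁ ≡ true → q A₂ ≡ true → q Y ≡ q P xor q X →
  map (map (flipLit q)) (parityBlock P X Y A₁ A₂ u) ↭ parityBlock P X Y A₁ A₂ (not u)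
parityBlock-flip q {P} {X} {Y} {A₁} {A₂} u qA₁ qA₂ qY with q P | q X | q Y | q A₁ | q A₂
... | false | false | false | true | true = ↭-refl
... | false | true  | true  | true | true = swap _ _ (swap _ _ ↭-refl)
... | true  | false | true  | true | true = ↭.++-comm (_ ∷ _ ∷ []) (_ ∷ _ ∷ [])
... | true  | true  | false | true | true =
  ↭-trans (swap _ _ (swap _ _ ↭-refl)) (↭.++-comm (_ ∷ _ ∷ []) (_ ∷ _ ∷ []))

module QUParityRefutation (n₂ : ℕ) where

  n : ℕ
  n = 2 + n₂

  open QUParity n

  m : ℕ
  m = suc (n + n)

  2+n≤n+y : ∀ {j} → 2 ≤ j → suc (suc n) ≤ n + j
  2+n≤n+y {j} 2≤j = subst (_≤ n + j) (+-comm n 2) (+-monoʳ-≤ n 2≤j)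

  -- A value on each quantifier block x₁ ⋯ x_n | a₁ a₂ | y₂ ⋯ y_n; prefixQ i is byRegion (toℕ i) ∃q ∀q ∃q.
  byRegion : ∀ {A : Set} → ℕ → A → A → A → A
  byRegion v x a y = if v <ᵇ n then x else if v <ᵇ n + 2 then a else y

  byRegion-x : ∀ {A : Set} {v} {x a y : A} → v < n → byRegion v x a y ≡ x
  byRegion-x {v = v} {x} {a} {y} v<n =
    cong (λ c → if c then x else if v <ᵇ n + 2 then a else y) (<ᵇ-true v<n)

  byRegion-a : ∀ {A : Set} {v} {x a y : A} → n ≤ v → v < suc (suc n) → byRegion v x a y ≡ a
  byRegion-a {v = v} {x} {a} {y} n≤v v<2+n =
    cong₂ (λ c d → if c then x else if d then a else y)
          (<ᵇ-false n≤v) (<ᵇ-true (subst (v <_) (+-comm 2 n) v<2+n))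

  byRegion-y : ∀ {A : Set} {v} {x a y : A} → suc (suc n) ≤ v → byRegion v x a y ≡ y
  byRegion-y {v = v} {x} {a} {y} 2+n≤v =
    cong₂ (λ c d → if c then x else if d then a else y)
          (<ᵇ-false (≤-trans (m≤n+m n 2) 2+n≤v)) (<ᵇ-false (subst (_≤ v) (+-comm 2 n) 2+n≤v))

  prefixQ-fromℕ< : ∀ {v} (v<m : v < m) → prefixQ (fromℕ< v<m) ≡ byRegion v ∃q ∀q ∃q
  prefixQ-fromℕ< v<m = cong (λ w → byRegion w ∃q ∀q ∃q) (toℕ-fromℕ< v<m)

  -- σ t negates x_{t+1} (index t), a₁, a₂ and the y_j with j > t (index n + j).
  flips : ℕ → ℕ → Bool
  flips t v = byRegion v (v ≡ᵇ t) true (t <ᵇ v ∸ n)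

  flips-x : ∀ t {v} → v < n → flips t v ≡ (v ≡ᵇ t)
  flips-x t = byRegion-x

  flips-a : ∀ t {v} → n ≤ v → v < suc (suc n) → flips t v ≡ true
  flips-a t = byRegion-a

  flips-y : ∀ t {j} → 2 ≤ j → flips t (n + j) ≡ (t <ᵇ j)
  flips-y t {j} 2≤j = trans (byRegion-y (2+n≤n+y 2≤j)) (cong (t <ᵇ_) (m+n∸m≡n n j))

  flips-prev : ∀ t i → flips t (prev (2 + i)) ≡ (t <ᵇ suc i)
  flips-prev zero    zero    = refl
  flips-prev (suc t) zero    = refl
  flips-prev t       (suc i) = flips-y t (s≤s (s≤s z≤n))

  -- y_j is negated iff exactly one of y_{j-1} and x_j is, so σ t preserves the constraint y_j = y_{j-1} ⊕ x_j.
  block-flip : ∀ t u i → i < suc n₂ →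
    map (map (flipLit (flips t))) (block u (2 + i)) ↭ block (not u) (2 + i)
  block-flip t u i i<1+n₂ = parityBlock-flip (flips t) u
    (flips-a t ≤-refl (n≤1+n (suc n))) (flips-a t (n≤1+n n) ≤-refl)
    (begin
      flips t (yv (2 + i))                             ≡⟨ flips-y t (s≤s (s≤s z≤n)) ⟩
      t <ᵇ suc (suc i)                                 ≡⟨ <ᵇ-suc t (suc i) ⟩
      (t <ᵇ suc i) xor (suc i ≡ᵇ t)                    ≡⟨ cong₂ _xor_ (flips-prev t i) (flips-x t (s≤s i<1+n₂)) ⟨
      flips t (prev (2 + i)) xor flips t (xv (2 + i))  ∎)
    where open ≡-Reasoning

  blockPair : ℕ → List (List (ℕ × Bool))
  blockPair j = block true j ++ block false j

  blockPair-flip : ∀ t {j} → j ∈ js → map (map (flipLit (flips t))) (blockPair j) ↭ blockPair j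
  blockPair-flip t j∈js with ∈-map⁻ (2 +_) j∈js
  ... | i , i∈ , refl =
    ↭-trans (↭-reflexive (map-++ (map (flipLit (flips t))) (block true (2 + i)) (block false (2 + i))))
            (↭-trans (↭.++⁺ (block-flip t true i (∈-upTo⁻ i∈)) (block-flip t false i (∈-upTo⁻ i∈)))
                     (↭.++-comm (block false (2 + i)) (block true (2 + i))))

  E-flip : ∀ t → t < n → map (map (flipLit (flips t))) (E₁ ∷ E₂ ∷ []) ↭ E₁ ∷ E₂ ∷ []
  E-flip t t<n rewrite flips-a t {a₁} ≤-refl (n≤1+n (suc n)) | flips-a t {a₂} (n≤1+n n) ≤-refl
                     | flips-y t {n} (s≤s (s≤s z≤n)) | <ᵇ-true t<n = swap _ _ ↭-refl

  σ-isSymmetry : ∀ t → t < n → IsSymmetry formula (flipping prefixQ (flips t))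
  σ-isSymmetry t t<n = flipping-isSymmetry prefixQ (flips t) clauses
    (↭-trans (↭-reflexive (map-++ σ-clause (concatMap blockPair js) (E₁ ∷ E₂ ∷ [])))
             (↭.++⁺ (map-concatMap-↭ σ-clause blockPair js (blockPair-flip t)) (E-flip t t<n)))
    where
    σ-clause : List (ℕ × Bool) → List (ℕ × Bool)
    σ-clause = map (flipLit (flips t))

  F : QBF m
  F = formula

  -- The clause x_{k+1} ∨ ⋯ ∨ x_n ∨ a₁ ∨ a₂ ∨ y_k, where y₁ stands for x₁ (= prev 2).
  ChainVars : ℕ → ℕ → Set
  ChainVars k v = (k ≤ v × v < suc (suc n)) ⊎ v ≡ prev (suc k)

  chainStart : DerivesWithin F (Positive (ChainVars n)) 0
  chainStart = axiom (∈-map⁺ mkClause (∈-++⁺ʳ (concatMap blockPair js) (here refl)))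
                     (Exactly-resp E₁-lits (Exactly-mkClause E₁))
    where
    E₁-lits : litsOf E₁ ≐ Positive (ChainVars n)
    E₁-lits v b = mk⇔ fwd bwd
      where
      fwd : (v , b) ∈ E₁ → Positive (ChainVars n) v b
      fwd (here refl)                 = refl , inj₁ (≤-refl , n≤1+n (suc n))
      fwd (there (here refl))         = refl , inj₁ (n≤1+n n , ≤-refl)
      fwd (there (there (here refl))) = refl , inj₂ refl
      bwd : Positive (ChainVars n) v b → (v , b) ∈ E₁
      bwd (refl , inj₂ refl) = there (there (here refl))
      bwd (refl , inj₁ (n≤v , v<2+n)) with m≤n⇒m<n∨m≡n n≤v
      ... | inj₂ refl = here refl
      ... | inj₁ n<v with ≤-antisym (m<1+n⇒m≤n v<2+n) n<v
      ...   | refl = there (here refl)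

  chainStep : ∀ k → k < suc n₂ → ∀ {b} → DerivesWithin F (Positive (ChainVars (suc (suc k)))) b →
    DerivesWithin F (Positive (ChainVars (suc k))) (1 + b)
  chainStep k k<1+n₂ d =
    resolveWithAxiom d D∈F (fromℕ< y<m) (toℕ-fromℕ< y<m) (trans (prefixQ-fromℕ< y<m) (byRegion-y 2+n≤y))
      (Exactly-resp (litsOf-oneNegative (there (there (here refl))) onlyNegative) (Exactly-mkClause D))
      (inj₂ refl) resolvedVars
    where
    j : ℕ
    j = 2 + k
    D : List (ℕ × Bool)
    D = (prev j , true) ∷ (xv j , true) ∷ (yv j , false) ∷ (a₁ , true) ∷ (a₂ , true) ∷ []
    D∈F : mkClause D ∈ matrix F
    D∈F = ∈-map⁺ mkClause (∈-++⁺ˡ (∈-concatMap⁺ blockPair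
            (Any.map (λ { refl → there (there (there (here refl))) }) (∈-map⁺ (2 +_) (∈-upTo⁺ k<1+n₂)))))
    j≤n : j ≤ n
    j≤n = s≤s k<1+n₂
    1+k≤n : suc k ≤ n
    1+k≤n = ≤-trans (n≤1+n (suc k)) j≤n
    2+n≤y : suc (suc n) ≤ n + j
    2+n≤y = 2+n≤n+y (s≤s (s≤s z≤n))
    y<m : n + j < m
    y<m = s≤s (+-monoʳ-≤ n j≤n)
    onlyNegative : ∀ {v} → (v , false) ∈ D → v ≡ n + j
    onlyNegative (there (there (here refl)))                 = refl
    onlyNegative (there (there (there (here ()))))
    onlyNegative (there (there (there (there (here ())))))
    resolvedVars : ∀ v → ((ChainVars j v × v ≢ n + j) ⊎ (v , true) ∈ D) ⇔ ChainVars (suc k) v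
    resolvedVars v = mk⇔ fwd bwd
      where
      fwd : (ChainVars j v × v ≢ n + j) ⊎ (v , true) ∈ D → ChainVars (suc k) v
      fwd (inj₁ (inj₁ (j≤v , v<2+n) , _))                    = inj₁ (<⇒≤ j≤v , v<2+n)
      fwd (inj₁ (inj₂ v≡y , v≢y))                            = ⊥-elim (v≢y v≡y)
      fwd (inj₂ (here refl))                                 = inj₂ refl
      fwd (inj₂ (there (here refl)))                         = inj₁ (≤-refl , ≤-trans j≤n (m≤n+m n 2))
      fwd (inj₂ (there (there (there (here refl)))))         = inj₁ (1+k≤n , n≤1+n (suc n))
      fwd (inj₂ (there (there (there (there (here refl)))))) = inj₁ (≤-trans 1+k≤n (n≤1+n n) , ≤-refl)
      bwd : ChainVars (suc k) v → (ChainVars j v × v ≢ n + j) ⊎ (v , true) ∈ D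
      bwd (inj₂ refl) = inj₂ (here refl)
      bwd (inj₁ (1+k≤v , v<2+n)) with m≤n⇒m<n∨m≡n 1+k≤v
      ... | inj₂ refl = inj₂ (there (here refl))
      ... | inj₁ 1+k<v = inj₁ (inj₁ (1+k<v , v<2+n) , <⇒≢ (<-≤-trans v<2+n 2+n≤y))

  chainEnd : ∀ v → ChainVars 1 v ⇔ v < suc (suc n)
  chainEnd v = mk⇔ fwd (bwd v)
    where
    fwd : ChainVars 1 v → v < suc (suc n)
    fwd (inj₁ (_ , v<2+n)) = v<2+n
    fwd (inj₂ refl)        = s≤s z≤n
    bwd : ∀ v → v < suc (suc n) → ChainVars 1 v
    bwd zero    _     = inj₂ refl
    bwd (suc _) v<2+n = inj₁ (s≤s z≤n , v<2+n)

  symmetricStep : ∀ t → t < n → ∀ {b} →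
    DerivesWithin F (Positive (_< suc t)) b → DerivesWithin F (Positive (_< t)) (2 + b)
  symmetricStep t t<n d =
    resolveWithFlipped (flips t) (σ-isSymmetry t t<n) d
      (fromℕ< t<m) (toℕ-fromℕ< t<m) (trans (prefixQ-fromℕ< t<m) (byRegion-x t<n)) flipped ≤-refl resolvedVars
    where
    t<m : t < m
    t<m = ≤-trans t<n (≤-trans (m≤m+n n n) (n≤1+n (n + n)))
    flips-t : flips t t ≡ true
    flips-t = trans (flips-x t t<n) (to T-≡ (≡⇒≡ᵇ t t refl))
    flips-below : ∀ {v} → v < t → flips t v ≡ false
    flips-below {v} v<t = trans (flips-x t (<-trans v<t t<n)) (¬-not λ v≡ᵇt → <⇒≢ v<t (≡ᵇ⇒≡ v t (from T-≡ v≡ᵇt)))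
    flipped : flipLits (flips t) (Positive (_< suc t)) ≐ (Negative t ∪ˡ Positive (_< t))
    flipped v b = mk⇔ fwd bwd
      where
      fwd : Positive (_< suc t) v (flips t v xor b) → (Negative t ∪ˡ Positive (_< t)) v b
      fwd (flipped-b , v<1+t) with m≤n⇒m<n∨m≡n (m<1+n⇒m≤n v<1+t)
      ... | inj₂ refl = inj₁ (¬-not (to not-≡-true (trans (cong (_xor b) (sym flips-t)) flipped-b)) , refl)
      ... | inj₁ v<t  = inj₂ (trans (sym (cong (_xor b) (flips-below v<t))) flipped-b , v<t)
      bwd : (Negative t ∪ˡ Positive (_< t)) v b → Positive (_< suc t) v (flips t v xor b)
      bwd (inj₁ (refl , refl)) = cong (_xor false) flips-t , ≤-refl
      bwd (inj₂ (refl , v<t))  = cong (_xor true) (flips-below v<t) , m≤n⇒m≤1+n v<t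
    resolvedVars : ∀ v → ((v < suc t × v ≢ t) ⊎ v < t) ⇔ v < t
    resolvedVars v = mk⇔ (λ { (inj₁ (v<1+t , v≢t)) → ≤∧≢⇒< (m<1+n⇒m≤n v<1+t) v≢t ; (inj₂ v<t) → v<t }) inj₂

  universalReductions : ∀ {b} →
    DerivesWithin F (Positive (_< suc (suc n))) b → DerivesWithin F (Positive (_< n)) (2 + b)
  universalReductions d =
    reduceUniversal (fromℕ< a₁<m) (toℕ-fromℕ< a₁<m) (trans (prefixQ-fromℕ< a₁<m) (byRegion-a ≤-refl (n≤1+n (suc n))))
      (reduceUniversal (fromℕ< a₂<m) (toℕ-fromℕ< a₂<m) (trans (prefixQ-fromℕ< a₂<m) (byRegion-a (n≤1+n n) ≤-refl))
        d)
    where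
    a₁<m : n < m
    a₁<m = s≤s (m≤m+n n n)
    a₂<m : suc n < m
    a₂<m = s≤s (subst (_≤ n + n) (+-comm n 1) (+-monoʳ-≤ n (s≤s z≤n)))

  stepCount : n * 2 + (2 + (suc n₂ * 1 + 0)) ≤ 3 * n + 2
  stepCount = ≤-trans (n≤1+n _) (≤-reflexive total)
    where
    open +-*-Solver
    total : suc (n * 2 + (2 + (suc n₂ * 1 + 0))) ≡ 3 * n + 2
    total = solve 1 (λ x → con 1 :+ ((con 2 :+ x) :* con 2 :+ (con 2 :+ ((con 1 :+ x) :* con 1 :+ con 0)))
                           := con 3 :* (con 2 :+ x) :+ con 2) refl n₂

mainTheorem5 : (n : ℕ) → 1 < n → RefutableWithin (QUPARITY n) (3 * n + 2)
mainTheorem5 (suc zero) (s≤s ())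
mainTheorem5 (suc (suc n₂)) _ =
  refutation (λ _ _ (_ , v<0) → n≮0 v<0) (DerivesWithin-weaken stepCount afterSymmetries)
  where
  open QUParityRefutation n₂
  afterChain : DerivesWithin F (Positive (ChainVars 1)) (suc n₂ * 1 + 0)
  afterChain = descend (λ k → Positive (ChainVars (suc k))) 1 (suc n₂) chainStep chainStart
  afterReductions : DerivesWithin F (Positive (_< n)) (2 + (suc n₂ * 1 + 0))
  afterReductions = universalReductions (DerivesWithin-resp (Positive-resp chainEnd) afterChain)
  afterSymmetries : DerivesWithin F (Positive (_< 0)) (n * 2 + (2 + (suc n₂ * 1 + 0)))
  afterSymmetries = descend (λ t → Positive (_< t)) 2 n symmetricStep afterReductions
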